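{- Let $G$ be a $P_6$-free graph and $\Omega$ a potential maximal clique in $G$. Let $v_1,v_2\in\Omega$ with $v_1v_2\notin E(G)$ be such that there is exactly one connected component $D_0$ of $G-\Omega$ with $\{v_1,v_2\}\subseteq N(D_0)$, and suppose moreover that $D_0$ is the only connected component of $G-\Omega$ whose neighbourhood contains $v_1$. Then $$\Omega=(N(v_1)\setminus V(D_0))\cup N(D_0).$$
   Context: Graphs are finite and simple; $P_6$-free means no induced path on $6$ vertices. $N(v)$ is the open neighbourhood of $v$; for a vertex set or induced subgraph $D$, $N(D)$ is the set of vertices outside $D$ with a neighbour in $D$. A set $\Omega\subseteq V(G)$ is a potential maximal clique if (PMC1) no connected component $D$ of $G-\Omega$ satisfies $N(D)=\Omega$, and (PMC2) for every two non-adjacent $u,v\in\Omega$ there is a component $D$ of $G-\Omega$ with $\{u,v\}\subseteq N(D)$. -}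

module Defs where

open import Data.Nat using (ℕ; suc)
open import Data.Bool using (Bool; true; false)
open import Data.Fin using (Fin; toℕ)
open import Data.Fin.Subset using (Subset; _∈_; _∉_)
open import Data.Product using (Σ; ∃; _×_; _,_)
open import Data.Sum using (_⊎_)
open import Relation.Binary.PropositionalEquality using (_≡_; _≢_)
open import Relation.Nullary using (¬_)
open import Function.Bundles using (_⇔_)
open import Function.Definitions using (Injective)

record Graph (n : ℕ) : Set where
  field
    adj     : Fin n → Fin n → Bool
    symm    : ∀ u v → adj u v ≡ adj v u
    irrefl  : ∀ v → adj v v ≡ false

open Graph public

module _ {n : ℕ} (G : Graph n) where

  Adj : Fin n → Fin n → Set
  Adj u v = adj G u v ≡ true

  data PathIn (S : Subset n) : Fin n → Fin n → Set where
    here : ∀ {u} → u ∈ S → PathIn S u u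
    step : ∀ {u w v} → u ∈ S → Adj u w → PathIn S w v → PathIn S u v

  IsComponent : Subset n → Subset n → Set
  IsComponent Ω D =
      (∃ λ u → u ∈ D)
    × (∀ u → u ∈ D → u ∉ Ω)
    × (∀ u v → u ∈ D → v ∈ D → PathIn D u v)
    × (∀ u v → u ∈ D → v ∉ Ω → Adj u v → v ∈ D)

  InNbhd : Subset n → Fin n → Set
  InNbhd D v = v ∉ D × (∃ λ u → u ∈ D × Adj u v)

  IsPMC : Subset n → Set
  IsPMC Ω =
      (∀ D → IsComponent Ω D → ¬ (∀ v → InNbhd D v ⇔ v ∈ Ω))
    × (∀ u v → u ∈ Ω → v ∈ Ω → u ≢ v → ¬ Adj u v →
         ∃ λ D → IsComponent Ω D × InNbhd D u × InNbhd D v)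

  Consecutive : Fin 6 → Fin 6 → Set
  Consecutive i j = toℕ j ≡ suc (toℕ i) ⊎ toℕ i ≡ suc (toℕ j)

  P6Free : Set
  P6Free = ∀ (f : Fin 6 → Fin n) → Injective _≡_ _≡_ f →
           ¬ (∀ i j → Adj (f i) (f j) ⇔ Consecutive i j)

module Submission where

-- Write N₁ = N(v₁) \ D₀.  Two facts about components of G - Ω
-- hold in every graph:
--   (a) the neighbourhood N(D) of a component D lies inside Ω (components are
--       closed under adjacency outside Ω), and
--   (b) every vertex outside Ω lies in some component of G - Ω, obtained by
--       growing a connected set around the vertex until it is closed.
-- For "⊆": let w ∈ Ω.  If v₁w is an edge then w ∈ N₁ (w ∉ D₀ since D₀ avoids
-- Ω); if w = v₁ then w ∈ N(D₀); otherwise (PMC2) some component D sees both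
-- v₁ and w, and D = D₀ because D₀ is the only component seeing v₁.
-- For "⊇": N(D₀) ⊆ Ω by (a); if w ∈ N₁ were outside Ω, its component D from
-- (b) would see v₁, hence equal D₀, contradicting w ∉ D₀.

open import Defs
open import Data.Nat using (ℕ; zero; suc; _≤_; _<_; _+_)
open import Data.Nat.Properties
  using (≤-trans; <-≤-trans; ≤-<-trans; <-irrefl; +-suc; +-identityʳ; +-monoˡ-≤; m≤n+m)
open import Data.Fin using (Fin)
open import Data.Fin.Properties using (any?) renaming (_≟_ to _≟F_)
open import Data.Fin.Subset using (Subset; _∈_; _∉_; _∪_; ⁅_⁆; ∣_∣; _⊆_)
open import Data.Fin.Subset.Properties
  using (_∈?_; x∈p∪q⁺; x∈p∪q⁻; p⊆p∪q; x∈⁅x⁆; x∈⁅y⁆⇒x≡y; p⊂q⇒∣p∣<∣q∣; ∣p∣≤n)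
open import Data.Product using (_×_; _,_; ∃₂; Σ)
open import Data.Sum using (_⊎_; inj₁; inj₂)
open import Data.Bool using (true)
open import Data.Bool.Properties using () renaming (_≟_ to _≟B_)
open import Data.Empty using (⊥-elim)
open import Relation.Binary.PropositionalEquality using (_≡_; _≢_; refl; sym; trans; subst)
open import Relation.Nullary using (¬_; Dec; yes; no)
open import Relation.Nullary.Decidable using (_×-dec_; ¬?)
open import Function.Bundles using (_⇔_; mk⇔)

module _ {n : ℕ} (G : Graph n) where

  adj-sym : ∀ {u v} → Adj G u v → Adj G v u
  adj-sym {u} {v} uv = trans (symm G v u) uv

  walk-end : ∀ {S u v} → PathIn G S u v → v ∈ S
  walk-end (here v∈S)     = v∈S
  walk-end (step _ _ p)   = walk-end p

  walk-mono : ∀ {S T u v} → S ⊆ T → PathIn G S u v → PathIn G T u v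
  walk-mono S⊆T (here u∈S)        = here (S⊆T u∈S)
  walk-mono S⊆T (step u∈S uw p)   = step (S⊆T u∈S) uw (walk-mono S⊆T p)

  walk-++ : ∀ {S u v x} → PathIn G S u v → PathIn G S v x → PathIn G S u x
  walk-++ (here _)          q = q
  walk-++ (step u∈S uw p)   q = step u∈S uw (walk-++ p q)

  walk-rev : ∀ {S u v} → PathIn G S u v → PathIn G S v u
  walk-rev (here v∈S)      = here v∈S
  walk-rev (step u∈S uw p) =
    walk-++ (walk-rev p) (step (walk-end (walk-rev p)) (adj-sym uw) (here u∈S))

  module _ (Ω : Subset n) where

    -- (a) A component is closed under edges leaving it outside Ω, so its
    -- neighbourhood lies in Ω.
    nbhd⊆Ω : ∀ {D w} → IsComponent G Ω D → InNbhd G D w → w ∈ Ω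
    nbhd⊆Ω {D} {w} (_ , _ , _ , closed) (w∉D , u , u∈D , uw) with w ∈? Ω
    ... | yes w∈Ω = w∈Ω
    ... | no  w∉Ω = ⊥-elim (w∉D (closed u w u∈D w∉Ω uw))

    -- A seed around w: a set containing w, avoiding Ω, all of whose vertices
    -- reach w inside it.  A closed seed is a component containing w.
    record Seed (w : Fin n) (S : Subset n) : Set where
      field
        root  : w ∈ S
        avoid : ∀ u → u ∈ S → u ∉ Ω
        reach : ∀ u → u ∈ S → PathIn G S u w
    open Seed

    Exit : Subset n → Fin n → Fin n → Set
    Exit S u v = u ∈ S × v ∉ Ω × Adj G u v × v ∉ S

    exit? : ∀ S u v → Dec (Exit S u v)
    exit? S u v =
      (u ∈? S) ×-dec (¬? (v ∈? Ω) ×-dec ((adj G u v ≟B true) ×-dec ¬? (v ∈? S)))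

    singleton-seed : ∀ {w} → w ∉ Ω → Seed w ⁅ w ⁆
    singleton-seed {w} w∉Ω = record
      { root  = x∈⁅x⁆ w
      ; avoid = λ u u∈ → subst (_∉ Ω) (sym (x∈⁅y⁆⇒x≡y w u∈)) w∉Ω
      ; reach = λ u u∈ → subst (λ z → PathIn G ⁅ w ⁆ z w)
                               (sym (x∈⁅y⁆⇒x≡y w u∈)) (here (x∈⁅x⁆ w))
      }

    extend : ∀ {w S u v} → Seed w S → Exit S u v → Seed w (S ∪ ⁅ v ⁆)
    extend {w} {S} {u} {v} seed (u∈S , v∉Ω , uv , _) = record
      { root  = S⊆S' (root seed)
      ; avoid = avoid'
      ; reach = reach'
      }
      where
      S⊆S' : S ⊆ S ∪ ⁅ v ⁆
      S⊆S' = p⊆p∪q ⁅ v ⁆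
      avoid' : ∀ x → x ∈ S ∪ ⁅ v ⁆ → x ∉ Ω
      avoid' x x∈ with x∈p∪q⁻ S ⁅ v ⁆ x∈
      ... | inj₁ x∈S = avoid seed x x∈S
      ... | inj₂ x∈v rewrite x∈⁅y⁆⇒x≡y v x∈v = v∉Ω
      reach' : ∀ x → x ∈ S ∪ ⁅ v ⁆ → PathIn G (S ∪ ⁅ v ⁆) x w
      reach' x x∈ with x∈p∪q⁻ S ⁅ v ⁆ x∈
      ... | inj₁ x∈S = walk-mono S⊆S' (reach seed x x∈S)
      ... | inj₂ x∈v rewrite x∈⁅y⁆⇒x≡y v x∈v =
        step (x∈p∪q⁺ (inj₂ (x∈⁅x⁆ v))) (adj-sym uv) (walk-mono S⊆S' (reach seed u u∈S))

    extend-grows : ∀ {S u v} → Exit S u v → ∣ S ∣ < ∣ S ∪ ⁅ v ⁆ ∣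
    extend-grows {S} {v = v} (_ , _ , _ , v∉S) =
      p⊂q⇒∣p∣<∣q∣ (p⊆p∪q ⁅ v ⁆ , v , x∈p∪q⁺ (inj₂ (x∈⁅x⁆ v)) , v∉S)

    closed-seed-component : ∀ {w S} → Seed w S → (¬ ∃₂ (Exit S)) → IsComponent G Ω S
    closed-seed-component {w} {S} seed no-exit =
      (w , root seed) , avoid seed , connected , closed
      where
      connected : ∀ u v → u ∈ S → v ∈ S → PathIn G S u v
      connected u v u∈S v∈S = walk-++ (reach seed u u∈S) (walk-rev (reach seed v v∈S))
      closed : ∀ u v → u ∈ S → v ∉ Ω → Adj G u v → v ∈ S
      closed u v u∈S v∉Ω uv with v ∈? S
      ... | yes v∈S = v∈S
      ... | no  v∉S = ⊥-elim (no-exit (u , v , u∈S , v∉Ω , uv , v∉S))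

    -- Grow a seed until it is closed; the fuel k bounds the remaining growth.
    grow : ∀ {w} (k : ℕ) (S : Subset n) → Seed w S → n ≤ ∣ S ∣ + k →
           Σ (Subset n) λ D → IsComponent G Ω D × w ∈ D
    grow k S seed bound with any? (λ u → any? (λ v → exit? S u v))
    ... | no no-exit = S , closed-seed-component seed no-exit , root seed
    grow zero S seed bound | yes (u , v , e) =
      ⊥-elim (<-irrefl refl
        (≤-<-trans (subst (n ≤_) (+-identityʳ _) bound)
                   (<-≤-trans (extend-grows e) (∣p∣≤n (S ∪ ⁅ v ⁆)))))
    grow (suc k) S seed bound | yes (u , v , e) =
      grow k (S ∪ ⁅ v ⁆) (extend seed e)
        (≤-trans bound (subst (_≤ ∣ S ∪ ⁅ v ⁆ ∣ + k) (sym (+-suc _ k))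
                              (+-monoˡ-≤ k (extend-grows e))))

    component-of : ∀ w → w ∉ Ω → Σ (Subset n) λ D → IsComponent G Ω D × w ∈ D
    component-of w w∉Ω = grow n ⁅ w ⁆ (singleton-seed w∉Ω) (m≤n+m n _)

    non-nbr⊆N[D₀] : IsPMC G Ω → ∀ {v D₀ w} → v ∈ Ω →
      (∀ D → IsComponent G Ω D → InNbhd G D v → D ≡ D₀) →
      w ∈ Ω → v ≢ w → ¬ Adj G v w → InNbhd G D₀ w
    non-nbr⊆N[D₀] (_ , pmc2) {v} {D₀} {w} v∈Ω only-D₀ w∈Ω v≢w ¬vw
      with pmc2 v w v∈Ω w∈Ω v≢w ¬vw
    ... | D , D-comp , v∈N[D] , w∈N[D] =
      subst (λ X → InNbhd G X w) (only-D₀ D D-comp v∈N[D]) w∈N[D]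

    -- A neighbour w ∉ Ω of v ∈ Ω puts v into N(D) for the component D of w;
    -- so if D₀ is the only component seeing v, then N(v) \ D₀ ⊆ Ω (by (b)).
    nbr-outside⊆Ω : ∀ {v D₀ w} → v ∈ Ω →
      (∀ D → IsComponent G Ω D → InNbhd G D v → D ≡ D₀) →
      Adj G v w → w ∉ D₀ → w ∈ Ω
    nbr-outside⊆Ω {v} {D₀} {w} v∈Ω only-D₀ vw w∉D₀ with w ∈? Ω
    ... | yes w∈Ω = w∈Ω
    ... | no  w∉Ω with component-of w w∉Ω
    ...   | D , D-comp@(_ , D-avoids , _) , w∈D =
      ⊥-elim (w∉D₀ (subst (w ∈_) (only-D₀ D D-comp v∈N[D]) w∈D))
      where
      v∈N[D] : InNbhd G D v
      v∈N[D] = (λ v∈D → D-avoids v v∈D v∈Ω) , w , w∈D , adj-sym vw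

lemma3p9 : ∀ {n : ℕ} (G : Graph n) → P6Free G →
    ∀ (Ω : Subset n) → IsPMC G Ω →
    ∀ (v₁ v₂ : Fin n) → v₁ ∈ Ω → v₂ ∈ Ω → v₁ ≢ v₂ → ¬ Adj G v₁ v₂ →
    ∀ (D₀ : Subset n) → IsComponent G Ω D₀ →
    InNbhd G D₀ v₁ → InNbhd G D₀ v₂ →
    (∀ D → IsComponent G Ω D → InNbhd G D v₁ → InNbhd G D v₂ → D ≡ D₀) →
    (∀ D → IsComponent G Ω D → InNbhd G D v₁ → D ≡ D₀) →
    ∀ (w : Fin n) → w ∈ Ω ⇔ ((Adj G v₁ w × w ∉ D₀) ⊎ InNbhd G D₀ w)
lemma3p9 G _ Ω pmc v₁ _ v₁∈Ω _ _ _ D₀ D₀-comp@(_ , D₀-avoids , _) v₁∈N[D₀] _ _ only-D₀ w =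
  mk⇔ to from
  where
  to : w ∈ Ω → (Adj G v₁ w × w ∉ D₀) ⊎ InNbhd G D₀ w
  to w∈Ω with adj G v₁ w ≟B true | w ≟F v₁
  ... | yes v₁w | _        = inj₁ (v₁w , λ w∈D₀ → D₀-avoids w w∈D₀ w∈Ω)
  ... | no  _   | yes refl = inj₂ v₁∈N[D₀]
  ... | no ¬v₁w | no  w≢v₁ =
    inj₂ (non-nbr⊆N[D₀] G Ω pmc v₁∈Ω only-D₀ w∈Ω (λ e → w≢v₁ (sym e)) ¬v₁w)
  from : (Adj G v₁ w × w ∉ D₀) ⊎ InNbhd G D₀ w → w ∈ Ω
  from (inj₁ (v₁w , w∉D₀)) = nbr-outside⊆Ω G Ω v₁∈Ω only-D₀ v₁w w∉D₀
  from (inj₂ w∈N[D₀])      = nbhd⊆Ω G Ω D₀-comp w∈N[D₀]
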